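{- Let $G$ be a finite simple connected graph and let $a,b: V(G)\to\mathbb{R}^+$ be weights. Let $\{F_1,\ldots,F_r\}$ be a partition of $E(G)$ that is coarser than the $\Theta^*$-partition of $E(G)$. For each $i\in\{1,\ldots,r\}$ define $a_i,b_i: V(G/F_i)\to\mathbb{R}^+$ by $a_i(C)=\sum_{x\in V(C)}a(x)$ and $b_i(C)=\sum_{x\in V(C)}b(x)$ for every connected component $C$ of $G\setminus F_i$. Then $$W(G,a,b)=\sum_{i=1}^r W(G/F_i,a_i,b_i).$$
   Context: For a connected graph $H$ with weights $a,b:V(H)\to\mathbb{R}^+$, the Wiener index of the double vertex-weighted graph $(H,a,b)$ is $W(H,a,b)=\sum_{\{u,v\}\subseteq V(H)}(a(u)b(v)+a(v)b(u))\,d_H(u,v)$, where $d_H$ is the shortest-path distance and the sum is over unordered pairs of distinct vertices. Two edges $u_1v_1$, $u_2v_2$ are in relation $\Theta$ (Djoković–Winkler relation) if $d(u_1,u_2)+d(v_1,v_2)\neq d(u_1,v_2)+d(v_1,u_2)$; $\Theta^*$ is the transitive closure of $\Theta$, and its equivalence classes form the $\Theta^*$-partition of $E(G)$. A partition $\{F_1,\ldots,F_r\}$ of $E(G)$ is coarser than the $\Theta^*$-partition if each $F_i$ is a union of one or more $\Theta^*$-classes. For $F\subseteq E(G)$, the quotient graph $G/F$ has as vertices the connected components of $G\setminus F$ (the graph obtained by deleting the edges of $F$), two components $C_1,C_2$ being adjacent if some vertex of $C_1$ is adjacent in $G$ to some vertex of $C_2$. -}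

module Defs where

open import Level using (Level; _⊔_)
open import Data.Nat using (ℕ; zero; suc; _≤_)
import Data.Nat as ℕ
open import Data.Bool using (Bool; true; false)
open import Data.Fin using (Fin; toℕ)
open import Data.Nat using (_<?_)
open import Data.Product using (Σ; ∃; ∃-syntax; _×_; _,_)
open import Relation.Nullary using (¬_; yes; no)
open import Relation.Binary.PropositionalEquality using (_≡_; _≢_)
open import Relation.Binary.Construct.Closure.Transitive using (TransClosure)
open import Function using (Surjective; _⇔_)
open import Algebra.Bundles using (CommutativeSemiring)
import Algebra.Definitions.RawMonoid as RM

record SimpleGraph (n : ℕ) : Set where
  field
    adj    : Fin n → Fin n → Bool
    sym    : ∀ x y → adj x y ≡ adj y x
    irrefl : ∀ x → adj x x ≡ false
open SimpleGraph public

Adj : ∀ {n} → SimpleGraph n → Fin n → Fin n → Set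
Adj G x y = adj G x y ≡ true

data Walk {A : Set} (R : A → A → Set) : A → A → Set where
  [] : ∀ {x} → Walk R x x
  _∷_ : ∀ {x y z} → R x y → Walk R y z → Walk R x z

length : ∀ {A} {R : A → A → Set} {x y} → Walk R x y → ℕ
length [] = 0
length (_ ∷ w) = suc (length w)

Connected : ∀ {A} → (A → A → Set) → Set
Connected {A} R = ∀ (x y : A) → Walk R x y

IsDistOf : ∀ {A} → (A → A → Set) → A → A → ℕ → Set
IsDistOf R x y k = Σ (Walk R x y) (λ w → length w ≡ k)
                 × (∀ (w : Walk R x y) → k ≤ length w)

IsDistance : ∀ {A} → (A → A → Set) → (A → A → ℕ) → Set
IsDistance {A} R d = ∀ (x y : A) → IsDistOf R x y (d x y)

-- Edges (as ordered pairs; an unordered edge uv appears as (u,v) and (v,u))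

Edge : ∀ {n} → SimpleGraph n → Set
Edge {n} G = Σ (Fin n × Fin n) (λ { (u , v) → Adj G u v })

Θ : ∀ {n} (G : SimpleGraph n) (d : Fin n → Fin n → ℕ) → Edge G → Edge G → Set
Θ G d ((u₁ , v₁) , _) ((u₂ , v₂) , _) =
  d u₁ u₂ ℕ.+ d v₁ v₂ ≢ d u₁ v₂ ℕ.+ d v₁ u₂

Θ* : ∀ {n} (G : SimpleGraph n) (d : Fin n → Fin n → ℕ) → Edge G → Edge G → Set
Θ* G d = TransClosure (Θ G d)

-- A partition {F₁,…,F_r} of E(G) is given by a labelling of (ordered)
-- vertex pairs by Fin r; only its values on edges matter.
-- F i contains the edge uv iff cls u v ≡ i.

IsEdgePartition : ∀ {n r} (G : SimpleGraph n) → (Fin n → Fin n → Fin r) → Set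
IsEdgePartition {n} {r} G cls =
  (∀ u v → Adj G u v → cls u v ≡ cls v u)
  × (∀ (i : Fin r) → ∃[ u ] ∃[ v ] (Adj G u v × cls u v ≡ i))

CoarserThanΘ* : ∀ {n r} (G : SimpleGraph n) (d : Fin n → Fin n → ℕ)
                → (Fin n → Fin n → Fin r) → Set
CoarserThanΘ* G d cls =
  ∀ (e f : Edge G) → Θ* G d e f →
    cls (Data.Product.proj₁ (Data.Product.proj₁ e)) (Data.Product.proj₂ (Data.Product.proj₁ e))
    ≡ cls (Data.Product.proj₁ (Data.Product.proj₁ f)) (Data.Product.proj₂ (Data.Product.proj₁ f))

DelAdj : ∀ {n r} (G : SimpleGraph n) → (Fin n → Fin n → Fin r) → Fin r
         → Fin n → Fin n → Set
DelAdj G cls i x y = Adj G x y × cls x y ≢ i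

-- c : Fin n → Fin m labels the connected components of the relation R:
-- the m labels are exactly the components (c surjective, and
-- c x ≡ c y iff x and y are joined by a walk in R)
IsComponentLabelling : ∀ {n m} → (Fin n → Fin n → Set) → (Fin n → Fin m) → Set
IsComponentLabelling R c =
  Surjective _≡_ _≡_ c × (∀ x y → (c x ≡ c y) ⇔ Walk R x y)

QuotAdj : ∀ {n m} (G : SimpleGraph n) → (Fin n → Fin m) → Fin m → Fin m → Set
QuotAdj G c C D = C ≢ D × ∃[ x ] ∃[ y ] (c x ≡ C × c y ≡ D × Adj G x y)

module _ {c ℓ : Level} (R : CommutativeSemiring c ℓ) where
  open CommutativeSemiring R
  open RM +-rawMonoid using (sum) renaming (_×_ to _·_)

  -- Wiener index of the double vertex-weighted graph with distance d:
  -- sum over unordered pairs {x,y} of distinct vertices (x < y)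
  -- of (a x * b y + a y * b x) · d x y     (· = ℕ-multiple)
  Wiener : ∀ n → (a b : Fin n → Carrier) → (Fin n → Fin n → ℕ) → Carrier
  Wiener n a b d =
    sum (λ x → sum (λ y → pairTerm x y))
    where
      pairTerm : Fin n → Fin n → Carrier
      pairTerm x y with toℕ x <? toℕ y
      ... | yes _ = d x y · (a x * b y + a y * b x)
      ... | no _  = 0#

  compWeight : ∀ {n m} → (Fin n → Fin m) → (Fin n → Carrier) → Fin m → Carrier
  compWeight {n} c a C = sum (λ x → indicator x)
    where
      indicator : Fin n → Carrier
      indicator x with c x Data.Fin.≟ C
      ... | yes _ = a x
      ... | no _  = 0#

  sumOver : ∀ r → (Fin r → Carrier) → Carrier
  sumOver r f = sum f

-- A geodesic q from x to y has d(x,y) edges, each lying in exactly one part F_i, so it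
-- suffices that q contains exactly d_{G/F_i}(C_x, C_y) edges of F_i. Projecting q to G/F_i
-- gives a walk with at most that many steps, and lifting a geodesic of G/F_i through the
-- components gives a walk of G with at most d_{G/F_i}(C_x, C_y) edges of F_i; so it remains
-- to see that geodesics use the fewest F_i-edges among all walks with the same ends. For
-- that, let φ(w) be the sum of d(u,w) - d(v,w) over the F_i-edges uv of q. An edge outside
-- F_i is not Θ-related to any of them, so moving w along it leaves φ unchanged; moving w
-- along an edge of F_i changes φ by at most 2; and from x to y along q itself φ rises by
-- exactly 2 per F_i-edge. Once d(x,y) = Σ_i d_{G/F_i}(C_x, C_y), the identity for Wiener
-- indices is a rearrangement of finite sums, a_i and b_i collecting the terms of each component.

module Submission where

open import Defs
open import Level using (Level)
open import Data.Nat using (ℕ)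
open import Data.Fin using (Fin)
open import Algebra.Bundles using (CommutativeSemiring)

open import Algebra.Bundles using (CommutativeMonoid)
import Algebra.Definitions.RawMonoid as RawMonoidDefs
import Algebra.Properties.CommutativeMonoid.Sum as CommutativeMonoidSum
import Algebra.Properties.Semiring.Sum as SemiringSum
import Algebra.Properties.Monoid.Mult as MonoidMult
import Algebra.Properties.CommutativeMonoid.Mult as CommutativeMonoidMult
open import Data.Bool using (Bool; true; false; if_then_else_; not)
open import Data.Empty using (⊥-elim)
open import Function using (_∘_; case_of_)
open import Relation.Nullary.Decidable using (dec-false)
open import Data.Fin using (zero; suc; toℕ; _≟_)
open import Data.Fin.Properties using (toℕ-injective)
open import Data.Integer as ℤ using (ℤ; +_; 0ℤ)
import Data.Integer.Properties as ℤ
open import Data.Integer.Tactic.RingSolver using (solve-∀)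
open import Data.Nat as ℕ using (suc; _≤_; _<?_)
import Data.Nat.Properties as ℕ
open import Data.Product using (Σ; _×_; _,_; proj₁; proj₂)
open import Function.Bundles using (Equivalence)
open import Relation.Binary.Construct.Closure.Transitive using ([_])
open import Relation.Binary.PropositionalEquality as ≡
  using (_≡_; _≢_; refl; trans; cong; cong₂; subst; module ≡-Reasoning)
open import Relation.Nullary using (yes; no; does)

-- Walks and shortest-path distances

module _ {A : Set} {R : A → A → Set} where

  _++ʷ_ : ∀ {x y z} → Walk R x y → Walk R y z → Walk R x z
  [] ++ʷ q = q
  (e ∷ p) ++ʷ q = e ∷ (p ++ʷ q)

  length-++ʷ : ∀ {x y z} (p : Walk R x y) (q : Walk R y z) →
               length (p ++ʷ q) ≡ length p ℕ.+ length q
  length-++ʷ [] q = refl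
  length-++ʷ (e ∷ p) q = cong suc (length-++ʷ p q)

  reverseʷ : (∀ {x y} → R x y → R y x) → ∀ {x y} → Walk R x y → Walk R y x
  reverseʷ R-sym [] = []
  reverseʷ R-sym (e ∷ p) = reverseʷ R-sym p ++ʷ (R-sym e ∷ [])

  length-reverseʷ : (R-sym : ∀ {x y} → R x y → R y x) → ∀ {x y} (p : Walk R x y) →
                    length (reverseʷ R-sym p) ≡ length p
  length-reverseʷ R-sym [] = refl
  length-reverseʷ R-sym (e ∷ p) = begin
    length (reverseʷ R-sym p ++ʷ (R-sym e ∷ []))  ≡⟨ length-++ʷ (reverseʷ R-sym p) _ ⟩
    length (reverseʷ R-sym p) ℕ.+ 1               ≡⟨ ℕ.+-comm _ 1 ⟩
    suc (length (reverseʷ R-sym p))               ≡⟨ cong suc (length-reverseʷ R-sym p) ⟩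
    suc (length p)                                ∎
    where open ≡-Reasoning

+-tight : ∀ {a b A B} → a ≤ A → b ≤ B → A ℕ.+ B ≤ a ℕ.+ b → a ≡ A × b ≡ B
+-tight {a} {b} {A} {B} a≤A b≤B A+B≤a+b = a≡A , b≡B
  where
    a≡A : a ≡ A
    a≡A = ℕ.≤-antisym a≤A (ℕ.+-cancelʳ-≤ B A a (ℕ.≤-trans A+B≤a+b (ℕ.+-monoʳ-≤ a b≤B)))
    b≡B : b ≡ B
    b≡B = ℕ.≤-antisym b≤B (ℕ.+-cancelˡ-≤ A B b (subst (λ c → A ℕ.+ B ≤ c ℕ.+ b) a≡A A+B≤a+b))

module ShortestPaths {A : Set} (R : A → A → Set) (R-sym : ∀ {x y} → R x y → R y x)
                     (d : A → A → ℕ) (isDistance : IsDistance R d) where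

  d≤length : ∀ {x y} (p : Walk R x y) → d x y ≤ length p
  d≤length {x} {y} = proj₂ (isDistance x y)

  geodesic : ∀ x y → Σ (Walk R x y) (λ p → length p ≡ d x y)
  geodesic x y = proj₁ (isDistance x y)

  d-refl : ∀ x → d x x ≡ 0
  d-refl x = ℕ.n≤0⇒n≡0 (d≤length [])

  d-edge : ∀ {x y} → R x y → d x y ≤ 1
  d-edge e = d≤length (e ∷ [])

  d-sym : ∀ x y → d x y ≡ d y x
  d-sym x y = ℕ.≤-antisym (d-sym-≤ x y) (d-sym-≤ y x)
    where
      d-sym-≤ : ∀ x y → d x y ≤ d y x
      d-sym-≤ x y with geodesic y x
      ... | p , |p|≡d = subst (d x y ≤_) (trans (length-reverseʷ R-sym p) |p|≡d)
                              (d≤length (reverseʷ R-sym p))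

  d-triangle : ∀ x y z → d x z ≤ d x y ℕ.+ d y z
  d-triangle x y z with geodesic x y | geodesic y z
  ... | p , |p|≡ | q , |q|≡ =
    subst (d x z ≤_) (trans (length-++ʷ p q) (cong₂ ℕ._+_ |p|≡ |q|≡)) (d≤length (p ++ʷ q))

  d-step : ∀ x {y z} → R y z → d x z ≤ suc (d x y)
  d-step x {y} {z} e = ℕ.≤-trans (d-triangle x y z)
    (subst (d x y ℕ.+ d y z ≤_) (ℕ.+-comm (d x y) 1) (ℕ.+-monoʳ-≤ (d x y) (d-edge e)))

  geodesic-suffix : ∀ s {p t} (q : Walk R p t) → d s p ℕ.+ length q ≡ d s t → d p t ≡ length q
  geodesic-suffix s {p} {t} q h =
    proj₂ (+-tight ℕ.≤-refl (d≤length q) (subst (_≤ d s p ℕ.+ d p t) (≡.sym h) (d-triangle s p t)))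

  geodesic-advance : ∀ s {p x t} → R p x → (q : Walk R x t) →
                     d s p ℕ.+ suc (length q) ≡ d s t → d s x ≡ suc (d s p)
  geodesic-advance s {p} {x} {t} e q h =
    proj₁ (+-tight (d-step s e) (d≤length q)
                   (subst (_≤ d s x ℕ.+ d x t) (trans (≡.sym h) (ℕ.+-suc (d s p) (length q)))
                          (d-triangle s x t)))

  geodesic-tail : ∀ s {p x t} → R p x → (q : Walk R x t) →
                  d s p ℕ.+ suc (length q) ≡ d s t → d s x ℕ.+ length q ≡ d s t
  geodesic-tail s {p} e q h =
    trans (cong (ℕ._+ length q) (geodesic-advance s e q h)) (trans (≡.sym (ℕ.+-suc (d s p) (length q))) h)

-- Sums against a Kronecker delta

module KroneckerSum {c ℓ} (M : CommutativeMonoid c ℓ) where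
  open CommutativeMonoid M
    renaming (_∙_ to _+_; ε to 0#; identityˡ to +-identityˡ; identityʳ to +-identityʳ;
              refl to ≈-refl; trans to ≈-trans)
  open CommutativeMonoidSum M using (sum; sum-replicate-zero; sum-cong-≋; ∑-comm)
  open import Relation.Binary.Reasoning.Setoid setoid

  δ : ∀ {m} → Fin m → Fin m → Carrier → Carrier
  δ j C t = if does (j ≟ C) then t else 0#

  δ-sum : ∀ {m} (j : Fin m) (f : Fin m → Carrier) → sum (λ C → δ j C (f C)) ≈ f j
  δ-sum {suc m} zero f    = ≈-trans (∙-congˡ (sum-replicate-zero m)) (+-identityʳ (f zero))
  δ-sum {suc m} (suc j) f = ≈-trans (+-identityˡ _) (δ-sum j (λ C → f (suc C)))

  δ-natural : (g : Carrier → Carrier) → g 0# ≈ 0# → ∀ {m} (j C : Fin m) t → g (δ j C t) ≈ δ j C (g t)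
  δ-natural g g0≈0 j C t with does (j ≟ C)
  ... | true  = ≈-refl
  ... | false = g0≈0

  δ-cong : ∀ {m} (j C : Fin m) {t t′} → t ≈ t′ → δ j C t ≈ δ j C t′
  δ-cong j C t≈t′ with does (j ≟ C)
  ... | true  = t≈t′
  ... | false = ≈-refl

  ∑-δ : ∀ {m n} (j C : Fin m) (f : Fin n → Carrier) → sum (λ y → δ j C (f y)) ≈ δ j C (sum f)
  ∑-δ {n = n} j C f with does (j ≟ C)
  ... | true  = ≈-refl
  ... | false = sum-replicate-zero n

  sum-fibres : ∀ {n m} (c : Fin n → Fin m) (g : Fin n → Fin m → Carrier) →
               sum (λ C → sum (λ x → δ (c x) C (g x C))) ≈ sum (λ x → g x (c x))
  sum-fibres c g = begin
    sum (λ C → sum (λ x → δ (c x) C (g x C)))  ≈⟨ ∑-comm (λ C x → δ (c x) C (g x C)) ⟩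
    sum (λ x → sum (λ C → δ (c x) C (g x C)))  ≈⟨ sum-cong-≋ (λ x → δ-sum (c x) (g x)) ⟩
    sum (λ x → g x (c x))                      ∎

module ℕSum = CommutativeMonoidSum ℕ.+-0-commutativeMonoid
module ℕKronecker = KroneckerSum ℕ.+-0-commutativeMonoid

-- Geodesics cross every Θ*-closed set of edges as rarely as possible

pos-diff-cong : ∀ a b c e → a ℕ.+ b ≡ c ℕ.+ e → + a ℤ.- + e ≡ + c ℤ.- + b
pos-diff-cong a b c e h = begin
  + a ℤ.- + e                         ≡⟨ shift (+ a) (+ e) (+ b) ⟩
  (+ a ℤ.+ + b) ℤ.- (+ e ℤ.+ + b)     ≡⟨ cong (λ z → z ℤ.- (+ e ℤ.+ + b)) (cong +_ h) ⟩
  (+ c ℤ.+ + e) ℤ.- (+ e ℤ.+ + b)     ≡⟨ unshift (+ c) (+ e) (+ b) ⟩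
  + c ℤ.- + b                         ∎
  where
    open ≡-Reasoning
    shift : ∀ (A E B : ℤ) → A ℤ.- E ≡ (A ℤ.+ B) ℤ.- (E ℤ.+ B)
    shift = solve-∀
    unshift : ∀ (C E B : ℤ) → (C ℤ.+ E) ℤ.- (E ℤ.+ B) ≡ C ℤ.- B
    unshift = solve-∀

pos-diff-≤ : ∀ {x y} k → x ≤ k ℕ.+ y → + x ℤ.- + y ℤ.≤ + k
pos-diff-≤ {x} {y} k h = begin
  + x ℤ.- + y              ≤⟨ ℤ.+-monoˡ-≤ (ℤ.- + y) (ℤ.+≤+ h) ⟩
  (+ k ℤ.+ + y) ℤ.- + y    ≡⟨ cancel (+ k) (+ y) ⟩
  + k                      ∎
  where
    open ℤ.≤-Reasoning
    cancel : ∀ (K Y : ℤ) → (K ℤ.+ Y) ℤ.- Y ≡ K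
    cancel = solve-∀

Adj-sym : ∀ {n} (G : SimpleGraph n) {x y} → Adj G x y → Adj G y x
Adj-sym G {x} {y} e = trans (SimpleGraph.sym G y x) e

QuotAdj-sym : ∀ {n m} (G : SimpleGraph n) (c : Fin n → Fin m) {C D} → QuotAdj G c C D → QuotAdj G c D C
QuotAdj-sym G c (C≢D , x , y , cx≡C , cy≡D , e) = (λ D≡C → C≢D (≡.sym D≡C)) , y , x , cy≡D , cx≡C , Adj-sym G e

module EdgeClasses {n r} (G : SimpleGraph n)
                   (d : Fin n → Fin n → ℕ) (isDistance : IsDistance (Adj G) d)
                   (cls : Fin n → Fin n → Fin r) (coarse : CoarserThanΘ* G d cls) where
  open ShortestPaths (Adj G) (Adj-sym G) d isDistance

  gap : Fin n → Fin n → Fin n → ℤ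
  gap x y w = + d x w ℤ.- + d y w

  gap-trans : ∀ x y t w → gap x y w ℤ.+ gap y t w ≡ gap x t w
  gap-trans x y t w = telescope (+ d x w) (+ d y w) (+ d t w)
    where
      telescope : ∀ (X Y T : ℤ) → (X ℤ.- Y) ℤ.+ (Y ℤ.- T) ≡ X ℤ.- T
      telescope = solve-∀

  gap-invariant : ∀ {x y a b} → Adj G x y → Adj G a b → cls x y ≢ cls a b → gap x y a ≡ gap x y b
  gap-invariant {x} {y} {a} {b} xy ab cls≢ with d x a ℕ.+ d y b ℕ.≟ d x b ℕ.+ d y a
  ... | yes eq = pos-diff-cong (d x a) (d y b) (d x b) (d y a) eq
  ... | no xyΘab = ⊥-elim (cls≢ (coarse ((x , y) , xy) ((a , b) , ab) [ xyΘab ]))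

  gap-edge : ∀ p t {a b} → Adj G a b → gap p t b ℤ.- gap p t a ℤ.≤ + 2
  gap-edge p t {a} {b} ab = begin
    gap p t b ℤ.- gap p t a                                    ≡⟨ regroup (+ d p b) (+ d t b) (+ d p a) (+ d t a) ⟩
    (+ d p b ℤ.- + d p a) ℤ.+ (+ d t a ℤ.- + d t b)            ≤⟨ ℤ.+-mono-≤ (pos-diff-≤ 1 (d-step p ab))
                                                                             (pos-diff-≤ 1 (d-step t (Adj-sym G ab))) ⟩
    + 2                                                        ∎
    where
      open ℤ.≤-Reasoning
      regroup : ∀ (PB TB PA TA : ℤ) →
                (PB ℤ.- TB) ℤ.- (PA ℤ.- TA) ≡ (PB ℤ.- PA) ℤ.+ (TA ℤ.- TB)
      regroup = solve-∀

  gap-geodesic-edge : ∀ s {p x t} (e : Adj G p x) (q : Walk (Adj G) x t) →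
                      d s p ℕ.+ length (e ∷ q) ≡ d s t → gap p x t ℤ.- gap p x s ≡ + 2
  gap-geodesic-edge s {p} {x} {t} e q h = begin
    (+ d p t ℤ.- + d x t) ℤ.- (+ d p s ℤ.- + d x s)
      ≡⟨ cong₂ (λ u v → (+ u ℤ.- + v) ℤ.- (+ d p s ℤ.- + d x s))
               (geodesic-suffix s (e ∷ q) h) (geodesic-suffix s q (geodesic-tail s e q h)) ⟩
    (+ suc (length q) ℤ.- + length q) ℤ.- (+ d p s ℤ.- + d x s)
      ≡⟨ cong₂ (λ u v → (+ suc (length q) ℤ.- + length q) ℤ.- (+ u ℤ.- + v))
               (d-sym p s) (trans (d-sym x s) (geodesic-advance s e q h)) ⟩
    (+ suc (length q) ℤ.- + length q) ℤ.- (+ d s p ℤ.- + suc (d s p))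
      ≡⟨ unit-steps (+ length q) (+ d s p) ⟩
    + 2 ∎
    where
      open ≡-Reasoning
      unit-steps : ∀ (L D : ℤ) → ((+ 1 ℤ.+ L) ℤ.- L) ℤ.- (D ℤ.- (+ 1 ℤ.+ D)) ≡ + 2
      unit-steps = solve-∀

  potential : (Fin r → Bool) → ∀ {p t} → Walk (Adj G) p t → Fin n → ℤ
  potential S [] w = 0ℤ
  potential S (_∷_ {x} {y} _ q) w = (if S (cls x y) then gap x y w else 0ℤ) ℤ.+ potential S q w

  count : (Fin r → Bool) → ∀ {p t} → Walk (Adj G) p t → ℕ
  count S [] = 0
  count S (_∷_ {x} {y} _ q) = (if S (cls x y) then 1 else 0) ℕ.+ count S q

  potential-split : ∀ S {p t} (q : Walk (Adj G) p t) w →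
                    potential S q w ℤ.+ potential (not ∘ S) q w ≡ gap p t w
  potential-split S {p} [] w = ≡.sym (ℤ.+-inverseʳ (+ d p w))
  potential-split S {t = t} (_∷_ {x} {y} _ q) w = begin
    ((if S (cls x y) then gap x y w else 0ℤ) ℤ.+ potential S q w) ℤ.+
    ((if not (S (cls x y)) then gap x y w else 0ℤ) ℤ.+ potential (not ∘ S) q w)
      ≡⟨ select-split (S (cls x y)) (gap x y w) (potential S q w) (potential (not ∘ S) q w) ⟩
    gap x y w ℤ.+ (potential S q w ℤ.+ potential (not ∘ S) q w)
      ≡⟨ cong (ℤ._+_ (gap x y w)) (potential-split S q w) ⟩
    gap x y w ℤ.+ gap y t w
      ≡⟨ gap-trans x y t w ⟩
    gap x t w ∎
    where
      open ≡-Reasoning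
      select-split : ∀ s (G P Q : ℤ) →
        ((if s then G else 0ℤ) ℤ.+ P) ℤ.+ ((if not s then G else 0ℤ) ℤ.+ Q) ≡ G ℤ.+ (P ℤ.+ Q)
      select-split true  = in-S
        where
          in-S : ∀ (G P Q : ℤ) → (G ℤ.+ P) ℤ.+ (0ℤ ℤ.+ Q) ≡ G ℤ.+ (P ℤ.+ Q)
          in-S = solve-∀
      select-split false = not-in-S
        where
          not-in-S : ∀ (G P Q : ℤ) → (0ℤ ℤ.+ P) ℤ.+ (G ℤ.+ Q) ≡ G ℤ.+ (P ℤ.+ Q)
          not-in-S = solve-∀

  potential-invariant : ∀ S {a b} → Adj G a b → S (cls a b) ≡ false →
                        ∀ {p t} (q : Walk (Adj G) p t) → potential S q a ≡ potential S q b
  potential-invariant S ab ∉S [] = refl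
  potential-invariant S {a} {b} ab ∉S (_∷_ {x} {y} xy q) with S (cls x y) in ∈S
  ... | true  = cong₂ ℤ._+_ (gap-invariant xy ab (λ same → case trans (≡.sym ∈S) (trans (cong S same) ∉S) of λ ()))
                            (potential-invariant S ab ∉S q)
  ... | false = cong (ℤ._+_ 0ℤ) (potential-invariant S ab ∉S q)

  potential-step : ∀ S {p t} (q : Walk (Adj G) p t) {a b} → Adj G a b →
                   potential S q b ℤ.- potential S q a ℤ.≤ (if S (cls a b) then + 2 else 0ℤ)
  potential-step S {p} {t} q {a} {b} ab with S (cls a b) in ab∈S
  ... | false = ℤ.≤-reflexive (trans (cong (ℤ._- potential S q a) (≡.sym (potential-invariant S ab ab∈S q)))
                                     (ℤ.+-inverseʳ (potential S q a)))
  -- the two potentials sum to d p - d t, and the one of the classes outside S is constant on ab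
  ... | true  = begin
    potential S q b ℤ.- potential S q a
      ≡⟨ add-both (potential S q b) (potential S q a) (potential (not ∘ S) q b) ⟩
    (potential S q b ℤ.+ potential (not ∘ S) q b) ℤ.- (potential S q a ℤ.+ potential (not ∘ S) q b)
      ≡⟨ cong (λ z → (potential S q b ℤ.+ potential (not ∘ S) q b) ℤ.- (potential S q a ℤ.+ z))
              (≡.sym (potential-invariant (not ∘ S) ab (cong not ab∈S) q)) ⟩
    (potential S q b ℤ.+ potential (not ∘ S) q b) ℤ.- (potential S q a ℤ.+ potential (not ∘ S) q a)
      ≡⟨ cong₂ ℤ._-_ (potential-split S q b) (potential-split S q a) ⟩
    gap p t b ℤ.- gap p t a
      ≤⟨ gap-edge p t ab ⟩
    + 2 ∎
    where
      open ℤ.≤-Reasoning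
      add-both : ∀ (X Y Z : ℤ) → X ℤ.- Y ≡ (X ℤ.+ Z) ℤ.- (Y ℤ.+ Z)
      add-both = solve-∀

  double-count-∷ : ∀ s c → (if s then + 2 else 0ℤ) ℤ.+ + (2 ℕ.* c) ≡ + (2 ℕ.* ((if s then 1 else 0) ℕ.+ c))
  double-count-∷ true  c = cong +_ (≡.sym (ℕ.*-distribˡ-+ 2 1 c))
  double-count-∷ false c = refl

  potential-rise-≤ : ∀ S {p t} (q : Walk (Adj G) p t) {a b} (w : Walk (Adj G) a b) →
                     potential S q b ℤ.- potential S q a ℤ.≤ + (2 ℕ.* count S w)
  potential-rise-≤ S q {a} [] = ℤ.≤-reflexive (ℤ.+-inverseʳ (potential S q a))
  potential-rise-≤ S q {a} {b} (_∷_ {y = a₁} e w) = begin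
    potential S q b ℤ.- potential S q a
      ≡⟨ split-rise (potential S q a) (potential S q a₁) (potential S q b) ⟩
    (potential S q a₁ ℤ.- potential S q a) ℤ.+ (potential S q b ℤ.- potential S q a₁)
      ≤⟨ ℤ.+-mono-≤ (potential-step S q e) (potential-rise-≤ S q w) ⟩
    (if S (cls a a₁) then + 2 else 0ℤ) ℤ.+ + (2 ℕ.* count S w)
      ≡⟨ double-count-∷ (S (cls a a₁)) (count S w) ⟩
    + (2 ℕ.* count S (e ∷ w)) ∎
    where
      open ℤ.≤-Reasoning
      split-rise : ∀ (A A₁ B : ℤ) → B ℤ.- A ≡ (A₁ ℤ.- A) ℤ.+ (B ℤ.- A₁)
      split-rise = solve-∀

  potential-rise-geodesic : ∀ S s {p t} (q : Walk (Adj G) p t) → d s p ℕ.+ length q ≡ d s t →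
                            potential S q t ℤ.- potential S q s ≡ + (2 ℕ.* count S q)
  potential-rise-geodesic S s [] h = refl
  potential-rise-geodesic S s {p} {t} (_∷_ {y = x} e q) h = begin
    ((if S (cls p x) then gap p x t else 0ℤ) ℤ.+ potential S q t) ℤ.-
    ((if S (cls p x) then gap p x s else 0ℤ) ℤ.+ potential S q s)
      ≡⟨ regroup (S (cls p x)) (gap p x t) (gap p x s) (potential S q t) (potential S q s) ⟩
    (if S (cls p x) then gap p x t ℤ.- gap p x s else 0ℤ) ℤ.+ (potential S q t ℤ.- potential S q s)
      ≡⟨ cong₂ ℤ._+_ (cong (if S (cls p x) then_else 0ℤ) (gap-geodesic-edge s e q h))
                     (potential-rise-geodesic S s q (geodesic-tail s e q h)) ⟩
    (if S (cls p x) then + 2 else 0ℤ) ℤ.+ + (2 ℕ.* count S q)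
      ≡⟨ double-count-∷ (S (cls p x)) (count S q) ⟩
    + (2 ℕ.* count S (e ∷ q)) ∎
    where
      open ≡-Reasoning
      regroup : ∀ s (G G₀ P P₀ : ℤ) →
        ((if s then G else 0ℤ) ℤ.+ P) ℤ.- ((if s then G₀ else 0ℤ) ℤ.+ P₀)
        ≡ (if s then G ℤ.- G₀ else 0ℤ) ℤ.+ (P ℤ.- P₀)
      regroup true  = in-S
        where
          in-S : ∀ (G G₀ P P₀ : ℤ) → (G ℤ.+ P) ℤ.- (G₀ ℤ.+ P₀) ≡ (G ℤ.- G₀) ℤ.+ (P ℤ.- P₀)
          in-S = solve-∀
      regroup false = not-in-S
        where
          not-in-S : ∀ (G G₀ P P₀ : ℤ) → (0ℤ ℤ.+ P) ℤ.- (0ℤ ℤ.+ P₀) ≡ 0ℤ ℤ.+ (P ℤ.- P₀)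
          not-in-S = solve-∀

  geodesic-count-minimal : ∀ S {s t} (q : Walk (Adj G) s t) → length q ≡ d s t →
                           (w : Walk (Adj G) s t) → count S q ≤ count S w
  geodesic-count-minimal S {s} {t} q |q|≡d w =
    ℕ.*-cancelˡ-≤ 2 (ℤ.drop‿+≤+ (subst (ℤ._≤ + (2 ℕ.* count S w))
                                       (potential-rise-geodesic S s q s-geodesic)
                                       (potential-rise-≤ S q w)))
    where
      s-geodesic : d s s ℕ.+ length q ≡ d s t
      s-geodesic = trans (cong (ℕ._+ length q) (d-refl s)) |q|≡d

  count-++ʷ : ∀ S {x y z} (p : Walk (Adj G) x y) (q : Walk (Adj G) y z) →
              count S (p ++ʷ q) ≡ count S p ℕ.+ count S q
  count-++ʷ S [] q = refl
  count-++ʷ S (_∷_ {x} {y} _ p) q =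
    trans (cong (ℕ._+_ (if S (cls x y) then 1 else 0)) (count-++ʷ S p q))
            (≡.sym (ℕ.+-assoc (if S (cls x y) then 1 else 0) (count S p) (count S q)))

  inClass : Fin r → Fin r → Bool
  inClass i j = does (j ≟ i)

  length≡∑count : ∀ {p t} (q : Walk (Adj G) p t) → length q ≡ ℕSum.sum (λ i → count (inClass i) q)
  length≡∑count [] = ≡.sym (ℕSum.sum-replicate-zero r)
  length≡∑count (_∷_ {x} {y} _ q) = ≡.sym (begin
    ℕSum.sum (λ i → ℕKronecker.δ (cls x y) i 1 ℕ.+ count (inClass i) q)
      ≡⟨ ℕSum.∑-distrib-+ (λ i → ℕKronecker.δ (cls x y) i 1) (λ i → count (inClass i) q) ⟩
    ℕSum.sum (λ i → ℕKronecker.δ (cls x y) i 1) ℕ.+ ℕSum.sum (λ i → count (inClass i) q)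
      ≡⟨ cong₂ ℕ._+_ (ℕKronecker.δ-sum (cls x y) (λ _ → 1)) (≡.sym (length≡∑count q)) ⟩
    suc (length q) ∎)
    where open ≡-Reasoning

  module QuotientByClass (i : Fin r) {m} (c : Fin n → Fin m)
                         (isComponents : IsComponentLabelling (DelAdj G cls i) c)
                         (dq : Fin m → Fin m → ℕ) (isQuotientDistance : IsDistance (QuotAdj G c) dq) where
    module quotient = ShortestPaths (QuotAdj G c) (QuotAdj-sym G c) dq isQuotientDistance

    same-component : ∀ {x y} → Walk (DelAdj G cls i) x y → c x ≡ c y
    same-component {x} {y} = Equivalence.from (proj₂ isComponents x y)

    walk-avoiding-class : ∀ {x y} → c x ≡ c y → Σ (Walk (Adj G) x y) (λ q → count (inClass i) q ≡ 0)
    walk-avoiding-class {x} {y} cx≡cy = avoid (Equivalence.to (proj₂ isComponents x y) cx≡cy)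
      where
        avoid : ∀ {x y} → Walk (DelAdj G cls i) x y → Σ (Walk (Adj G) x y) (λ q → count (inClass i) q ≡ 0)
        avoid [] = [] , refl
        avoid (_∷_ {x} {y} (e , cls≢i) w) =
          (e ∷ proj₁ (avoid w)) ,
          cong₂ ℕ._+_ (cong (if_then 1 else 0) (dec-false (cls x y ≟ i) cls≢i)) (proj₂ (avoid w))

    empty-walk : ∀ {C D} → C ≡ D → ∀ k → Σ (Walk (QuotAdj G c) C D) (λ W → length W ≤ k)
    empty-walk refl k = [] , ℕ.z≤n

    project-edge : ∀ {x y} → Adj G x y →
                   Σ (Walk (QuotAdj G c) (c x) (c y)) (λ W → length W ≤ (if inClass i (cls x y) then 1 else 0))
    project-edge {x} {y} e with c x ≟ c y
    ... | yes cx≡cy = empty-walk cx≡cy _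
    ... | no cx≢cy  = ((cx≢cy , x , y , refl , refl , e) ∷ []) , edge-in-class
      where
        edge-in-class : 1 ≤ (if inClass i (cls x y) then 1 else 0)
        edge-in-class with cls x y ≟ i
        ... | yes _     = ℕ.≤-refl
        ... | no cls≢i = ⊥-elim (cx≢cy (same-component ((e , cls≢i) ∷ [])))

    project : ∀ {x y} (q : Walk (Adj G) x y) →
              Σ (Walk (QuotAdj G c) (c x) (c y)) (λ W → length W ≤ count (inClass i) q)
    project [] = [] , ℕ.z≤n
    project (e ∷ q) with project-edge e | project q
    ... | W₁ , |W₁|≤ | W₂ , |W₂|≤ =
      (W₁ ++ʷ W₂) , subst (_≤ _) (≡.sym (length-++ʷ W₁ W₂)) (ℕ.+-mono-≤ |W₁|≤ |W₂|≤)

    lift : ∀ {C D} (W : Walk (QuotAdj G c) C D) {x y} → c x ≡ C → c y ≡ D →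
           Σ (Walk (Adj G) x y) (λ q → count (inClass i) q ≤ length W)
    lift [] cx≡C cy≡D with walk-avoiding-class (trans cx≡C (≡.sym cy≡D))
    ... | q , count≡0 = q , ℕ.≤-reflexive count≡0
    lift ((_ , x′ , y′ , cx′≡C , cy′≡C′ , e) ∷ W) cx≡C cy≡D
      with walk-avoiding-class (trans cx≡C (≡.sym cx′≡C)) | lift W cy′≡C′ cy≡D
    ... | q₁ , count₁≡0 | q₂ , count₂≤ =
      (q₁ ++ʷ (e ∷ q₂)) ,
      subst (_≤ suc (length W)) (≡.sym (trans (count-++ʷ (inClass i) q₁ (e ∷ q₂))
                                                 (cong (ℕ._+ count (inClass i) (e ∷ q₂)) count₁≡0)))
            (ℕ.+-mono-≤ (indicator≤1 (inClass i (cls x′ y′))) count₂≤)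
      where
        indicator≤1 : ∀ b → (if b then 1 else 0) ≤ 1
        indicator≤1 true  = ℕ.≤-refl
        indicator≤1 false = ℕ.z≤n

    geodesic-count≡quotient-distance : ∀ {x y} (q : Walk (Adj G) x y) → length q ≡ d x y →
                                       count (inClass i) q ≡ dq (c x) (c y)
    geodesic-count≡quotient-distance {x} {y} q |q|≡d with quotient.geodesic (c x) (c y)
    ... | W , |W|≡dq with lift W refl refl | project q
    ...   | q′ , count′≤|W| | Wq , |Wq|≤count = ℕ.≤-antisym
      (ℕ.≤-trans (geodesic-count-minimal (inClass i) q |q|≡d q′) (ℕ.≤-trans count′≤|W| (ℕ.≤-reflexive |W|≡dq)))
      (ℕ.≤-trans (quotient.d≤length Wq) |Wq|≤count)

  distance≡∑quotient-distances :
    (m : Fin r → ℕ) (comp : (i : Fin r) → Fin n → Fin (m i)) →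
    (∀ i → IsComponentLabelling (DelAdj G cls i) (comp i)) →
    (dq : (i : Fin r) → Fin (m i) → Fin (m i) → ℕ) →
    (∀ i → IsDistance (QuotAdj G (comp i)) (dq i)) →
    ∀ x y → d x y ≡ ℕSum.sum (λ i → dq i (comp i x) (comp i y))
  distance≡∑quotient-distances m comp isComponents dq isQuotientDistance x y with geodesic x y
  ... | q , |q|≡d = begin
    d x y                                              ≡⟨ ≡.sym |q|≡d ⟩
    length q                                           ≡⟨ length≡∑count q ⟩
    ℕSum.sum (λ i → count (inClass i) q)               ≡⟨ ℕSum.sum-cong-≗ count≡dq ⟩
    ℕSum.sum (λ i → dq i (comp i x) (comp i y))        ∎
    where
      open ≡-Reasoning
      count≡dq : ∀ i → count (inClass i) q ≡ dq i (comp i x) (comp i y)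
      count≡dq i = QuotientByClass.geodesic-count≡quotient-distance
                     i (comp i) (isComponents i) (dq i) (isQuotientDistance i) q |q|≡d

-- Wiener indices

module WienerAlgebra {c ℓ} (R : CommutativeSemiring c ℓ) where
  open CommutativeSemiring R hiding (zero)
    renaming (refl to ≈-refl; trans to ≈-trans; sym to ≈-sym; reflexive to ≈-reflexive)
  open RawMonoidDefs +-rawMonoid using (sum) renaming (_×_ to _·_)
  open SemiringSum semiring using (sum-cong-≋; sum-replicate-zero; ∑-comm; ∑-distrib-+; *-distribˡ-sum; *-distribʳ-sum)
  open MonoidMult +-monoid using (×-congˡ; ×-congʳ; ×-homo-+)
  open CommutativeMonoidMult +-commutativeMonoid using (×-distrib-+)
  open KroneckerSum +-commutativeMonoid using (δ; δ-sum; δ-natural; δ-cong; ∑-δ; sum-fibres)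
  open import Relation.Binary.Reasoning.Setoid setoid

  ×-zeroʳ : ∀ k → k · 0# ≈ 0#
  ×-zeroʳ 0       = ≈-refl
  ×-zeroʳ (suc k) = ≈-trans (+-identityˡ (k · 0#)) (×-zeroʳ k)

  ×-distribˡ-sum : ∀ k {n} (f : Fin n → Carrier) → k · sum f ≈ sum (λ x → k · f x)
  ×-distribˡ-sum 0       {n} f = ≈-sym (sum-replicate-zero n)
  ×-distribˡ-sum (suc k) f     = ≈-trans (+-congˡ (×-distribˡ-sum k f)) (≈-sym (∑-distrib-+ f (λ x → k · f x)))

  ×-distribʳ-sum : ∀ {r} (k : Fin r → ℕ) t → ℕSum.sum k · t ≈ sum (λ i → k i · t)
  ×-distribʳ-sum {0}     k t = ≈-refl
  ×-distribʳ-sum {suc r} k t = ≈-trans (×-homo-+ t (k zero) _) (+-congˡ (×-distribʳ-sum (λ i → k (suc i)) t))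

  sum-*-sum : ∀ {n m} (u : Fin n → Carrier) (v : Fin m → Carrier) →
              sum u * sum v ≈ sum (λ x → sum (λ y → u x * v y))
  sum-*-sum u v = ≈-trans (*-distribʳ-sum (sum v) u) (sum-cong-≋ (λ x → *-distribˡ-sum (u x) v))

  ×-δ-* : ∀ k {m} (j C l D : Fin m) u v → k · (δ j C u * δ l D v) ≈ δ l D (δ j C (k · (u * v)))
  ×-δ-* k j C l D u v = begin
    k · (δ j C u * δ l D v)   ≈⟨ δ-natural (λ z → k · (δ j C u * z)) (≈-trans (×-congʳ k (zeroʳ _)) (×-zeroʳ k)) l D v ⟩
    δ l D (k · (δ j C u * v)) ≈⟨ δ-cong l D (δ-natural (λ z → k · (z * v)) (≈-trans (×-congʳ k (zeroˡ v)) (×-zeroʳ k)) j C u) ⟩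
    δ l D (δ j C (k · (u * v))) ∎

  -- The summands of compWeight and Wiener are local functions of Defs; they appear as the
  -- metavariables below, which are solved by the first clause of each mutual block.
  mutual
    compWeight≈∑δ : ∀ {n m} (c : Fin n → Fin m) (a : Fin n → Carrier) C →
                    compWeight R c a C ≈ sum (λ x → δ (c x) C (a x))
    compWeight≈∑δ c a C = sum-cong-≋ (indicator≈δ c a C)

    indicator≈δ : ∀ {n m} (c : Fin n → Fin m) (a : Fin n → Carrier) C x → _ ≈ δ (c x) C (a x)
    indicator≈δ c a C x with c x ≟ C
    ... | yes _ = ≈-refl
    ... | no _  = ≈-refl

  upper : ∀ {n} → Fin n → Fin n → Carrier → Carrier
  upper x y t with toℕ x <? toℕ y
  ... | yes _ = t
  ... | no _  = 0#

  mutual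
    Wiener≈∑upper : ∀ n (a b : Fin n → Carrier) (h : Fin n → Fin n → ℕ) →
      Wiener R n a b h ≈ sum (λ x → sum (λ y → upper x y (h x y · (a x * b y + a y * b x))))
    Wiener≈∑upper n a b h = sum-cong-≋ (λ x → sum-cong-≋ (pairTerm≈upper n a b h x))

    pairTerm≈upper : ∀ n (a b : Fin n → Carrier) (h : Fin n → Fin n → ℕ) x y →
                     _ ≈ upper x y (h x y · (a x * b y + a y * b x))
    pairTerm≈upper n a b h x y with toℕ x <? toℕ y
    ... | yes _ = ≈-refl
    ... | no _  = ≈-refl

  upper-+ : ∀ {n} (x y : Fin n) u v → upper x y (u + v) ≈ upper x y u + upper x y v
  upper-+ x y u v with toℕ x <? toℕ y
  ... | yes _ = ≈-refl
  ... | no _  = ≈-sym (+-identityˡ 0#)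

  upper-pair : ∀ {n} (x y : Fin n) t → (x ≡ y → t ≈ 0#) → upper x y t + upper y x t ≈ t
  upper-pair x y t x≡y⇒t≈0 with toℕ x <? toℕ y | toℕ y <? toℕ x
  ... | yes x<y | yes y<x = ⊥-elim (ℕ.<-asym x<y y<x)
  ... | yes _   | no _    = +-identityʳ t
  ... | no _    | yes _   = +-identityˡ t
  ... | no x≮y  | no y≮x  =
    ≈-trans (+-identityˡ 0#) (≈-sym (x≡y⇒t≈0 (toℕ-injective (ℕ.≤-antisym (ℕ.≮⇒≥ y≮x) (ℕ.≮⇒≥ x≮y)))))

  ∑upper-symmetrise : ∀ {n} (f : Fin n → Fin n → Carrier) → (∀ x → f x x ≈ 0#) →
    sum (λ x → sum (λ y → upper x y (f x y + f y x))) ≈ sum (λ x → sum (λ y → f x y))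
  ∑upper-symmetrise f diagonal≈0 = begin
    sum (λ x → sum (λ y → upper x y (f x y + f y x)))
      ≈⟨ sum-cong-≋ (λ x → ≈-trans (sum-cong-≋ (λ y → upper-+ x y (f x y) (f y x)))
                                    (∑-distrib-+ (λ y → upper x y (f x y)) (λ y → upper x y (f y x)))) ⟩
    sum (λ x → sum (λ y → upper x y (f x y)) + sum (λ y → upper x y (f y x)))
      ≈⟨ ∑-distrib-+ (λ x → sum (λ y → upper x y (f x y))) (λ x → sum (λ y → upper x y (f y x))) ⟩
    sum (λ x → sum (λ y → upper x y (f x y))) + sum (λ x → sum (λ y → upper x y (f y x)))
      ≈⟨ +-congˡ (∑-comm (λ x y → upper x y (f y x))) ⟩
    sum (λ x → sum (λ y → upper x y (f x y))) + sum (λ x → sum (λ y → upper y x (f x y)))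
      ≈⟨ ≈-sym (∑-distrib-+ (λ x → sum (λ y → upper x y (f x y))) (λ x → sum (λ y → upper y x (f x y)))) ⟩
    sum (λ x → sum (λ y → upper x y (f x y)) + sum (λ y → upper y x (f x y)))
      ≈⟨ sum-cong-≋ (λ x → ≈-trans (≈-sym (∑-distrib-+ (λ y → upper x y (f x y)) (λ y → upper y x (f x y))))
                                    (sum-cong-≋ (λ y → upper-pair x y (f x y) (λ { refl → diagonal≈0 x })))) ⟩
    sum (λ x → sum (λ y → f x y)) ∎

  Wiener≈∑ordered : ∀ {n} (a b : Fin n → Carrier) (h : Fin n → Fin n → ℕ) →
    (∀ x y → h x y ≡ h y x) → (∀ x → h x x ≡ 0) →
    Wiener R n a b h ≈ sum (λ x → sum (λ y → h x y · (a x * b y)))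
  Wiener≈∑ordered {n} a b h h-sym h-diagonal = begin
    Wiener R n a b h
      ≈⟨ Wiener≈∑upper n a b h ⟩
    sum (λ x → sum (λ y → upper x y (h x y · (a x * b y + a y * b x))))
      ≈⟨ sum-cong-≋ (λ x → sum-cong-≋ (λ y → upper-cong x y (split x y))) ⟩
    sum (λ x → sum (λ y → upper x y (h x y · (a x * b y) + h y x · (a y * b x))))
      ≈⟨ ∑upper-symmetrise (λ x y → h x y · (a x * b y)) (λ x → ≈-reflexive (cong (_· (a x * b x)) (h-diagonal x))) ⟩
    sum (λ x → sum (λ y → h x y · (a x * b y))) ∎
    where
      split : ∀ x y → h x y · (a x * b y + a y * b x) ≈ h x y · (a x * b y) + h y x · (a y * b x)
      split x y = ≈-trans (×-distrib-+ (a x * b y) (a y * b x) (h x y)) (+-congˡ (×-congˡ (h-sym x y)))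
      upper-cong : ∀ x y {t t′} → t ≈ t′ → upper x y t ≈ upper x y t′
      upper-cong x y t≈t′ with toℕ x <? toℕ y
      ... | yes _ = t≈t′
      ... | no _  = ≈-refl

  ∑ordered-pushforward : ∀ {n m} (c : Fin n → Fin m) (k : Fin m → Fin m → ℕ) (a b : Fin n → Carrier) →
    sum (λ C → sum (λ D → k C D · (compWeight R c a C * compWeight R c b D)))
    ≈ sum (λ x → sum (λ y → k (c x) (c y) · (a x * b y)))
  ∑ordered-pushforward c k a b = begin
    sum (λ C → sum (λ D → k C D · (compWeight R c a C * compWeight R c b D)))
      ≈⟨ sum-cong-≋ (λ C → sum-cong-≋ (λ D → expand C D)) ⟩
    sum (λ C → sum (λ D → sum (λ x → sum (λ y → δ (c y) D (δ (c x) C (k C D · (a x * b y)))))))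
      ≈⟨ sum-cong-≋ (λ C → ∑-comm (λ D x → sum (λ y → δ (c y) D (δ (c x) C (k C D · (a x * b y)))))) ⟩
    sum (λ C → sum (λ x → sum (λ D → sum (λ y → δ (c y) D (δ (c x) C (k C D · (a x * b y)))))))
      ≈⟨ sum-cong-≋ (λ C → sum-cong-≋ (λ x → sum-fibres c (λ y D → δ (c x) C (k C D · (a x * b y))))) ⟩
    sum (λ C → sum (λ x → sum (λ y → δ (c x) C (k C (c y) · (a x * b y)))))
      ≈⟨ sum-cong-≋ (λ C → sum-cong-≋ (λ x → ∑-δ (c x) C (λ y → k C (c y) · (a x * b y)))) ⟩
    sum (λ C → sum (λ x → δ (c x) C (sum (λ y → k C (c y) · (a x * b y)))))
      ≈⟨ sum-fibres c (λ x C → sum (λ y → k C (c y) · (a x * b y))) ⟩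
    sum (λ x → sum (λ y → k (c x) (c y) · (a x * b y))) ∎
    where
      expand : ∀ C D → k C D · (compWeight R c a C * compWeight R c b D)
                       ≈ sum (λ x → sum (λ y → δ (c y) D (δ (c x) C (k C D · (a x * b y)))))
      expand C D = begin
        k C D · (compWeight R c a C * compWeight R c b D)
          ≈⟨ ×-congʳ (k C D) (*-cong (compWeight≈∑δ c a C) (compWeight≈∑δ c b D)) ⟩
        k C D · (sum (λ x → δ (c x) C (a x)) * sum (λ y → δ (c y) D (b y)))
          ≈⟨ ×-congʳ (k C D) (sum-*-sum (λ x → δ (c x) C (a x)) (λ y → δ (c y) D (b y))) ⟩
        k C D · sum (λ x → sum (λ y → δ (c x) C (a x) * δ (c y) D (b y)))
          ≈⟨ ≈-trans (×-distribˡ-sum (k C D) (λ x → sum (λ y → δ (c x) C (a x) * δ (c y) D (b y))))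
                     (sum-cong-≋ (λ x → ×-distribˡ-sum (k C D) (λ y → δ (c x) C (a x) * δ (c y) D (b y)))) ⟩
        sum (λ x → sum (λ y → k C D · (δ (c x) C (a x) * δ (c y) D (b y))))
          ≈⟨ sum-cong-≋ (λ x → sum-cong-≋ (λ y → ×-δ-* (k C D) (c x) C (c y) D (a x) (b y))) ⟩
        sum (λ x → sum (λ y → δ (c y) D (δ (c x) C (k C D · (a x * b y))))) ∎

  Wiener-additive : ∀ {n} (a b : Fin n → Carrier) (h : Fin n → Fin n → ℕ) →
    (∀ x y → h x y ≡ h y x) → (∀ x → h x x ≡ 0) →
    ∀ {r} (m : Fin r → ℕ) (c : (i : Fin r) → Fin n → Fin (m i)) (k : (i : Fin r) → Fin (m i) → Fin (m i) → ℕ) →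
    (∀ i C D → k i C D ≡ k i D C) → (∀ i C → k i C C ≡ 0) →
    (∀ x y → h x y ≡ ℕSum.sum (λ i → k i (c i x) (c i y))) →
    Wiener R n a b h ≈ sum (λ i → Wiener R (m i) (compWeight R (c i) a) (compWeight R (c i) b) (k i))
  Wiener-additive {n} a b h h-sym h-diagonal m c k k-sym k-diagonal h≡∑k = begin
    Wiener R n a b h
      ≈⟨ Wiener≈∑ordered a b h h-sym h-diagonal ⟩
    sum (λ x → sum (λ y → h x y · (a x * b y)))
      ≈⟨ sum-cong-≋ (λ x → sum-cong-≋ (λ y → ≈-trans (×-congˡ (h≡∑k x y)) (×-distribʳ-sum (λ i → k i (c i x) (c i y)) (a x * b y)))) ⟩
    sum (λ x → sum (λ y → sum (λ i → k i (c i x) (c i y) · (a x * b y))))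
      ≈⟨ ≈-trans (sum-cong-≋ (λ x → ∑-comm (λ y i → k i (c i x) (c i y) · (a x * b y))))
                 (∑-comm (λ x i → sum (λ y → k i (c i x) (c i y) · (a x * b y)))) ⟩
    sum (λ i → sum (λ x → sum (λ y → k i (c i x) (c i y) · (a x * b y))))
      ≈⟨ sum-cong-≋ (λ i → ≈-sym (∑ordered-pushforward (c i) (k i) a b)) ⟩
    sum (λ i → sum (λ C → sum (λ D → k i C D · (compWeight R (c i) a C * compWeight R (c i) b D))))
      ≈⟨ sum-cong-≋ (λ i → ≈-sym (Wiener≈∑ordered (compWeight R (c i) a) (compWeight R (c i) b) (k i) (k-sym i) (k-diagonal i))) ⟩
    sum (λ i → Wiener R (m i) (compWeight R (c i) a) (compWeight R (c i) b) (k i)) ∎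

mainTheorem1 : ∀ {c ℓ : Level} (R : CommutativeSemiring c ℓ)
    {n : ℕ} (G : SimpleGraph n) → Connected (Adj G)
    → (d : Fin n → Fin n → ℕ) → IsDistance (Adj G) d
    → (a b : Fin n → CommutativeSemiring.Carrier R)
    → {r : ℕ} (cls : Fin n → Fin n → Fin r)
    → IsEdgePartition G cls
    → CoarserThanΘ* G d cls
    → (m : Fin r → ℕ) (comp : (i : Fin r) → Fin n → Fin (m i))
    → (∀ i → IsComponentLabelling (DelAdj G cls i) (comp i))
    → (dq : (i : Fin r) → Fin (m i) → Fin (m i) → ℕ)
    → (∀ i → IsDistance (QuotAdj G (comp i)) (dq i))
    → CommutativeSemiring._≈_ R
        (Wiener R n a b d)
        (sumOver R r (λ i → Wiener R (m i)
                              (compWeight R (comp i) a)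
                              (compWeight R (comp i) b)
                              (dq i)))
mainTheorem1 R G _ d isDistance a b cls _ coarse m comp isComponents dq isQuotientDistance =
  WienerAlgebra.Wiener-additive R a b d G-dist.d-sym G-dist.d-refl m comp dq
    (λ i → quotient-dist.d-sym i) (λ i → quotient-dist.d-refl i)
    (EdgeClasses.distance≡∑quotient-distances G d isDistance cls coarse m comp isComponents dq isQuotientDistance)
  where
    module G-dist = ShortestPaths (Adj G) (Adj-sym G) d isDistance
    module quotient-dist i = ShortestPaths (QuotAdj G (comp i)) (QuotAdj-sym G (comp i)) (dq i) (isQuotientDistance i)
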